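{- Let $h:[n]\to[n]$ be any Hessenberg function and let $P_h$ be the poset on $[n]$ with $i<_{P_h}j$ iff $h(i)<j$. Let $\mathcal{N}_h$ be the set of monomials $x_1^{i_1}\cdots x_n^{i_n}$ with $0\le i_k\le h(k)-k$ for $1\le k\le n$. Define $\varphi$ on $\mathcal{N}_h$ as follows: start with a column consisting of one box containing $n$; for $k=n-1,\ldots,1$ in turn, if $i_k=0$ insert a new box containing $k$ at the bottom of the column; if $i_k>0$, list the entries $k+1,\ldots,h(k)$ (already in the column) in order from lowest to highest position, and insert a new box containing $k$ directly above the $i_k$-th lowest entry of this list. Then $\varphi$ is a well-defined bijection from $\mathcal{N}_h$ to the set of $P_h$-tableaux of shape $(1^n)$, and for every $x_1^{i_1}\cdots x_n^{i_n}\in\mathcal{N}_h$ one has $i_1+\cdots+i_n=\mathrm{inv}_{P_h}(\varphi(x_1^{i_1}\cdots x_n^{i_n}))$.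
   Context: A Hessenberg function is $h:[n]\to[n]$ with $i\le h(i)$ for all $i$ and $h(i)\le h(i+1)$. A $P_h$-tableau of shape $(1^n)$ is a single column of $n$ boxes containing each element of $[n]$ exactly once such that whenever $j$ is directly above $i$, $j\not<_{P_h}i$. A $P_h$-inversion of such a tableau $T$ is a pair $i<j$ (as integers) with $i$ in a higher box than $j$ and $i,j$ incomparable in $P_h$; $\mathrm{inv}_{P_h}(T)$ is the number of $P_h$-inversions. (The set $\mathcal{N}_h$ is a known basis of $H^*(\mathrm{Hess}(N,h))$ for $N$ regular nilpotent.) -}

module Defs where

open import Data.Nat using (ℕ; zero; suc; _∸_)
open import Data.Nat.ListAction using (sum)
open import Data.Fin using (Fin; toℕ; fromℕ; inject₁; _<_; _≤_; _<?_; _≤?_; _≟_)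
open import Data.List using (List; []; _∷_; _++_; [_]; filter; reverse; length; map; foldr; allFin)
open import Data.List.Relation.Unary.Unique.Propositional using (Unique)
open import Data.List.Relation.Unary.Linked using (Linked)
open import Data.List.Membership.Propositional using (_∈_)
open import Data.Maybe using (Maybe; just; nothing; _>>=_)
open import Data.Product using (_×_; _,_)
open import Relation.Nullary using (¬_; Dec; yes; no; does)
open import Relation.Nullary.Decidable using (_×-dec_; ¬?)
open import Relation.Binary.PropositionalEquality using (_≡_)
open import Data.Bool using (if_then_else_)

-- Convention: [n] = {1,…,n} is represented 0-indexed by Fin n
-- (the element i : Fin n stands for the integer i+1).  Differences
-- h(k) - k and all order comparisons are unaffected by this shift.

record IsHessenberg {n : ℕ} (h : Fin n → Fin n) : Set where
  field
    extensive : ∀ i → i ≤ h i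
    monotone  : ∀ i j → suc (toℕ i) ≡ toℕ j → h i ≤ h j

module _ {n : ℕ} (h : Fin n → Fin n) where

  _<P_ : Fin n → Fin n → Set
  i <P j = h i < j

  _<P?_ : (i j : Fin n) → Dec (i <P j)
  i <P? j = h i <? j

  Incomparable : Fin n → Fin n → Set
  Incomparable i j = ¬ (i <P j) × ¬ (j <P i)

  -- exponent vectors (i_1,…,i_n) of monomials in 𝒩_h : 0 ≤ i_k ≤ h(k) - k
  InN : (Fin n → ℕ) → Set
  InN e = ∀ k → e k Data.Nat.≤ (toℕ (h k) ∸ toℕ k)

  -- a column (shape (1^n)) is a list of entries read from top to bottom.
  -- P_h-tableau: each element of [n] exactly once, and whenever j is
  -- directly above i, not (j <_{P_h} i).
  IsTableau : List (Fin n) → Set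
  IsTableau T = Unique T × (∀ x → x ∈ T) × Linked (λ j i → ¬ (j <P i)) T

  inv : List (Fin n) → ℕ
  inv [] = 0
  inv (x ∷ xs) =
    length (filter (λ y → (x <? y) ×-dec (¬? (x <P? y) ×-dec ¬? (y <P? x))) xs)
    Data.Nat.+ inv xs

  -- r-th element (1-indexed) of a list, if it exists
  nth1 : List (Fin n) → ℕ → Maybe (Fin n)
  nth1 [] r = nothing
  nth1 (x ∷ xs) zero = nothing
  nth1 (x ∷ xs) (suc zero) = just x
  nth1 (x ∷ xs) (suc (suc r)) = nth1 xs (suc r)

  insertAbove : Fin n → Fin n → List (Fin n) → List (Fin n)
  insertAbove k t [] = []
  insertAbove k t (x ∷ xs) with x ≟ t
  ... | yes _ = k ∷ x ∷ xs
  ... | no _  = x ∷ insertAbove k t xs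

  -- one step of the algorithm, processing k with exponent i_k = r.
  -- The entries k+1,…,h(k) of the column, listed from lowest to highest
  -- position, are  reverse (filter (k < · ≤ h k) C).
  step : Fin n → ℕ → List (Fin n) → Maybe (List (Fin n))
  step k zero C = just (C ++ [ k ])
  step k (suc r) C with nth1 (reverse (filter (λ x → (k <? x) ×-dec (x ≤? h k)) C)) (suc r)
  ... | nothing = nothing
  ... | just t  = just (insertAbove k t C)

-- φ, defined for n = suc m ≥ 1.  Returns nothing exactly when some
-- requested i_k-th entry does not exist (i.e. φ is not well defined there).
-- Start with the column [n]; then process k = n-1, …, 1 in turn
-- (0-indexed: inject₁ j for j = m-1, …, 0).
φ : {m : ℕ} (h : Fin (suc m) → Fin (suc m)) → (Fin (suc m) → ℕ) → Maybe (List (Fin (suc m)))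
φ {m} h e = foldr (λ j acc → acc >>= step h (inject₁ j) (e (inject₁ j))) (just [ fromℕ m ]) (allFin m)

degree : {n : ℕ} → (Fin n → ℕ) → ℕ
degree {n} e = sum (map e (allFin n))

-- φ has an explicit inverse, the code of a column T: code T k counts the entries of (k, h k]
-- lying below k in T.  When φ processes k the column holds exactly the entries k+1, …, n, in
-- particular all h k - k entries of (k, h k], so the i_k-th lowest of them exists; inserting k
-- directly above it gives k the code i_k and leaves the codes of the larger entries unchanged.
-- The P_h-condition survives: the entries above k are larger than k, and the entry below k lies
-- in (k, h k].  Conversely, in a tableau the first entry below k that exceeds k lies in (k, h k],
-- since each entry is at most h of the entry above it and h z ≤ h k for the entries z ≤ k passed
-- on the way; so inserting k with exponent code T k into T restricted to the entries > k gives T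
-- restricted to the entries ≥ k, and φ (code T) = T.  Finally a P_h-inversion (i above j, i < j
-- incomparable) is exactly an entry j of (i, h i] below i, so inv T is the sum of the codes.

{-# OPTIONS --safe #-}
module Submission where

open import Defs
open import Data.Nat using (ℕ; zero; suc; _+_; _∸_; z≤n; s≤s; s≤s⁻¹)
  renaming (_≤_ to _≤ℕ_; _<_ to _<ℕ_)
open import Data.Nat.Properties as ℕ using (≤-trans; ≤-reflexive; ≮⇒≥; ≤⇒≯; <⇒≤)
open import Data.Nat.ListAction using (sum)
open import Data.Nat.ListAction.Properties using (sum-↭)
open import Data.Fin using (Fin; zero; suc; toℕ; fromℕ; fromℕ<; inject₁; _<_; _≤_; _<?_; _≤?_; _≟_)
open import Data.Fin.Properties
  using (toℕ-injective; toℕ-fromℕ<; toℕ-inject₁; toℕ<n; ≤fromℕ; ≤∧≢⇒<; ≤-antisym)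
import Data.Fin as Fin
open import Data.List
  using (List; []; _∷_; _++_; [_]; filter; length; reverse; map; foldr; allFin; tabulate; head; applyUpTo)
open import Data.List.Properties
  using (filter-++; filter-accept; filter-reject; filter-all; filter-none; filter-≐; ++-identityʳ; ++-assoc;
         reverse-++; unfold-reverse; length-reverse; length-map; length-applyUpTo; foldr-map; map-tabulate;
         map-cong; map-cong-local)
open import Data.List.Membership.Propositional using (_∈_; _∉_)
open import Data.List.Membership.Propositional.Properties
  using (∈-∃++; ∈-insert; ∈-filter⁺; ∈-filter⁻; ∈-map⁺; ∈-map⁻; ∈-applyUpTo⁺; ∈-applyUpTo⁻; ∈-allFin;
         ∈-++⁺ˡ; ∈-++⁺ʳ)
open import Data.List.Membership.Propositional.Properties.WithK using (unique∧set⇒bag)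
open import Data.List.Relation.Unary.All as All using (All; []; _∷_)
open import Data.List.Relation.Unary.All.Properties using (¬Any⇒All¬; All¬⇒¬Any)
open import Data.List.Relation.Unary.Any using (here; there)
open import Data.List.Relation.Unary.Linked as Linked using (Linked; []; [-]; _∷_)
open import Data.List.Relation.Unary.AllPairs using ([]; _∷_)
open import Data.List.Relation.Unary.Unique.Propositional using (Unique)
import Data.List.Relation.Unary.Unique.Propositional.Properties as Unique
open import Data.List.Relation.Binary.BagAndSetEquality using (∼bag⇒↭)
open import Data.List.Relation.Binary.Permutation.Propositional using (_↭_; ↭-sym; ↭⇒↭ₛ)
open import Data.List.Relation.Binary.Permutation.Propositional.Properties using (shift; ∈-resp-↭; ↭-length)
import Data.List.Relation.Binary.Permutation.Propositional.Properties as Perm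
open import Data.List.Relation.Binary.Permutation.Setoid.Properties using (Unique-resp-↭)
open import Data.List.Relation.Binary.Sublist.Propositional using (_⊆_; []; _∷_; _∷ʳ_; ⊆-refl)
open import Data.List.Relation.Binary.Sublist.Propositional.Properties using (filter⁺; length-mono-≤)
open import Data.Maybe using (just; _>>=_)
open import Data.Maybe.Properties using (just-injective)
open import Data.Maybe.Relation.Unary.All as Maybe using (just; nothing)
open import Data.Product using (_×_; _,_; ∃; ∃₂; proj₁; proj₂)
open import Data.Sum using (_⊎_; inj₁; inj₂)
open import Function using (_∘_; id; _⇔_; mk⇔; Equivalence)
open import Relation.Nullary using (¬_; yes; no; contradiction; _×-dec_)
open import Relation.Unary using (Decidable; _≐_)
open import Relation.Binary.PropositionalEquality
  using (_≡_; _≢_; refl; sym; trans; cong; cong₂; subst; setoid; module ≡-Reasoning)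

module _ {A : Set} where

  unique∧set⇒↭ : {xs ys : List A} → Unique xs → Unique ys → (∀ {x} → x ∈ xs ⇔ x ∈ ys) → xs ↭ ys
  unique∧set⇒↭ u v eq = ∼bag⇒↭ (unique∧set⇒bag u v eq)

  Unique-insert : ∀ xs {ys} {x : A} → Unique (xs ++ ys) → x ∉ xs ++ ys → Unique (xs ++ x ∷ ys)
  Unique-insert xs {ys} {x} u x∉ =
    Unique-resp-↭ (setoid A) (↭⇒↭ₛ (↭-sym (shift x xs ys))) (¬Any⇒All¬ (xs ++ ys) x∉ ∷ u)

  Unique-mid⇒∉ : ∀ xs {ys} {x : A} → Unique (xs ++ x ∷ ys) → x ∉ xs ++ ys
  Unique-mid⇒∉ xs {ys} {x} u
    with x≢ ∷ _ ← Unique-resp-↭ (setoid A) (↭⇒↭ₛ (shift x xs ys)) u = All¬⇒¬Any x≢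

  ∈-insert⁻ : ∀ xs {ys} {x y : A} → y ∈ xs ++ x ∷ ys → y ≡ x ⊎ y ∈ xs ++ ys
  ∈-insert⁻ xs {ys} {x} y∈ with ∈-resp-↭ (shift x xs ys) y∈
  ... | here y≡x = inj₁ y≡x
  ... | there y∈′ = inj₂ y∈′

  ∈-insert⁺ : ∀ xs {ys} {x y : A} → y ∈ xs ++ ys → y ∈ xs ++ x ∷ ys
  ∈-insert⁺ xs {ys} {x} y∈ = ∈-resp-↭ (↭-sym (shift x xs ys)) (there y∈)

  Linked-insert : ∀ {R : A → A → Set} xs {ys x} → Linked R (xs ++ ys) →
                  All (λ a → R a x) xs → Maybe.All (R x) (head ys) → Linked R (xs ++ x ∷ ys)
  Linked-insert [] {[]} _ [] nothing = [-]
  Linked-insert [] {y ∷ ys} l [] (just r) = r ∷ l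
  Linked-insert (a ∷ []) l (r ∷ []) hd = r ∷ Linked-insert [] (Linked.tail l) [] hd
  Linked-insert (a ∷ a′ ∷ xs) (r ∷ l) (_ ∷ rs) hd = r ∷ Linked-insert (a′ ∷ xs) l rs hd

  Linked-++⁻ʳ : ∀ {R : A → A → Set} xs {ys} → Linked R (xs ++ ys) → Linked R ys
  Linked-++⁻ʳ [] l = l
  Linked-++⁻ʳ (x ∷ xs) l = Linked-++⁻ʳ xs (Linked.tail l)

  module _ {P : A → Set} (P? : Decidable P) where

    filter-insert-reject : ∀ xs {ys x} → ¬ P x → filter P? (xs ++ x ∷ ys) ≡ filter P? (xs ++ ys)
    filter-insert-reject xs {ys} ¬Px = begin
      filter P? (xs ++ _ ∷ ys)        ≡⟨ filter-++ P? xs _ ⟩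
      filter P? xs ++ filter P? (_ ∷ ys) ≡⟨ cong (filter P? xs ++_) (filter-reject P? ¬Px) ⟩
      filter P? xs ++ filter P? ys    ≡⟨ filter-++ P? xs ys ⟨
      filter P? (xs ++ ys)            ∎
      where open ≡-Reasoning

    filter-filter : ∀ {Q : A → Set} (Q? : Decidable Q) → (∀ {x} → P x → Q x) →
                    ∀ xs → filter P? (filter Q? xs) ≡ filter P? xs
    filter-filter Q? P⇒Q [] = refl
    filter-filter Q? P⇒Q (x ∷ xs) with Q? x
    ... | yes _ with P? x
    ...   | yes _ = cong (x ∷_) (filter-filter Q? P⇒Q xs)
    ...   | no _  = filter-filter Q? P⇒Q xs
    filter-filter Q? P⇒Q (x ∷ xs) | no ¬q with P? x
    ...   | yes p = contradiction (P⇒Q p) ¬q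
    ...   | no _  = filter-filter Q? P⇒Q xs

    split-by-count : ∀ C {r} → r ≤ℕ length (filter P? C) →
                     ∃₂ λ B₁ B₂ → C ≡ B₁ ++ B₂ × length (filter P? B₂) ≡ r × Maybe.All P (head B₂)
    split-by-count [] z≤n = [] , [] , refl , refl , nothing
    split-by-count (x ∷ C) {r} r≤ with P? x
    ... | no _ with B₁ , B₂ , refl , count , hd ← split-by-count C r≤ = x ∷ B₁ , B₂ , refl , count , hd
    ... | yes p with r ℕ.≟ suc (length (filter P? C))
    ...   | yes refl = [] , x ∷ C , refl , cong length (filter-accept P? p) , just p
    ...   | no r≢ with B₁ , B₂ , refl , count , hd ← split-by-count C (s≤s⁻¹ (ℕ.≤∧≢⇒< r≤ r≢)) =
            x ∷ B₁ , B₂ , refl , count , hd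

interval : ℕ → ℕ → List ℕ
interval a b = applyUpTo (_+ suc a) (b ∸ a)

∈-interval : ∀ {a b v} → v ∈ interval a b ⇔ (a <ℕ v × v ≤ℕ b)
∈-interval {a} {b} {v} = mk⇔ to from
  where
  to : v ∈ interval a b → a <ℕ v × v ≤ℕ b
  to v∈ with i , i< , refl ← ∈-applyUpTo⁻ (_+ suc a) v∈ =
    ℕ.m≤n+m (suc a) i , s≤s⁻¹ (ℕ.m≤o∸n⇒m+n≤o (suc i) (s≤s (<⇒≤ a<b)) i<)
    where a<b = ℕ.m∸n≢0⇒n<m (λ b∸a≡0 → ℕ.n≮0 (subst (i <ℕ_) b∸a≡0 i<))
  from : a <ℕ v × v ≤ℕ b → v ∈ interval a b
  from (a<v , v≤b) = subst (_∈ interval a b) (ℕ.m∸n+n≡m a<v)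
    (∈-applyUpTo⁺ (_+ suc a) (ℕ.∸-monoˡ-< (s≤s v≤b) a<v))

interval-unique : ∀ a b → Unique (interval a b)
interval-unique a b = Unique.applyUpTo⁺₁ (_+ suc a) (b ∸ a)
  (λ i<j _ → ℕ.<⇒≢ i<j ∘ ℕ.+-cancelʳ-≡ (suc a) _ _)

length-interval : ∀ a b → length (interval a b) ≡ b ∸ a
length-interval a b = length-applyUpTo (_+ suc a) (b ∸ a)

_⋖_ : ∀ {n} → Fin n → Fin n → Set
k ⋖ k′ = toℕ k′ ≡ suc (toℕ k)

module _ {n} {k k′ : Fin n} (k⋖k′ : k ⋖ k′) where

  ⋖-<⇒≤ : ∀ {x : Fin n} → k < x → k′ ≤ x
  ⋖-<⇒≤ {x} = subst (_≤ℕ toℕ x) (sym k⋖k′)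

  ⋖-≤⇒< : ∀ {x : Fin n} → k′ ≤ x → k < x
  ⋖-≤⇒< {x} = subst (_≤ℕ toℕ x) k⋖k′

  ⋖-≰⇒≤ : ∀ {x : Fin n} → ¬ k′ ≤ x → x ≤ k
  ⋖-≰⇒≤ {x} k′≰x = s≤s⁻¹ (subst (toℕ x <ℕ_) k⋖k′ (ℕ.≰⇒> k′≰x))

  filter-≤-⋖ : ∀ {xs} → k ∉ xs → filter (k ≤?_) xs ≡ filter (k′ ≤?_) xs
  filter-≤-⋖ {[]} _ = refl
  filter-≤-⋖ {x ∷ xs} k∉ with k ≤? x
  ... | yes k≤x = begin
    filter (k ≤?_) (x ∷ xs)   ≡⟨ filter-accept (k ≤?_) k≤x ⟩
    x ∷ filter (k ≤?_) xs     ≡⟨ cong (x ∷_) (filter-≤-⋖ (k∉ ∘ there)) ⟩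
    x ∷ filter (k′ ≤?_) xs    ≡⟨ filter-accept (k′ ≤?_) (⋖-<⇒≤ (≤∧≢⇒< k≤x (k∉ ∘ here))) ⟨
    filter (k′ ≤?_) (x ∷ xs)  ∎
    where open ≡-Reasoning
  ... | no k≰x  = begin
    filter (k ≤?_) (x ∷ xs)   ≡⟨ filter-reject (k ≤?_) k≰x ⟩
    filter (k ≤?_) xs         ≡⟨ filter-≤-⋖ (k∉ ∘ there) ⟩
    filter (k′ ≤?_) xs        ≡⟨ filter-reject (k′ ≤?_) (k≰x ∘ <⇒≤ ∘ ⋖-≤⇒<) ⟨
    filter (k′ ≤?_) (x ∷ xs)  ∎
    where open ≡-Reasoning

descending-induction : ∀ {m} {X : Set} (P : Fin (suc m) → X → Set) (f : Fin (suc m) → X → X) {z : X} →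
                       P (fromℕ m) z →
                       (∀ {k k′ x} → k ⋖ k′ → P k′ x → P k (f k x)) →
                       P zero (foldr (λ j → f (inject₁ j)) z (allFin m))
descending-induction {zero} P f base step = base
descending-induction {suc m} P f {z} base step =
  step refl (subst (P (suc zero)) (sym tabulate-suc)
    (descending-induction (P ∘ suc) (f ∘ suc) base (step ∘ cong suc)))
  where
  tabulate-suc : foldr (λ j → f (inject₁ j)) z (tabulate suc)
               ≡ foldr (λ j → f (suc (inject₁ j))) z (allFin m)
  tabulate-suc = trans (cong (foldr (λ j → f (inject₁ j)) z) (sym (map-tabulate id (Fin.suc {n = m}))))
                       (foldr-map (λ j → f (inject₁ j)) Fin.suc z (allFin m))

module Hessenberg {n} {h : Fin n → Fin n} (H : IsHessenberg h) where

  mono-+ : ∀ d {i j : Fin n} → toℕ j ≡ d + toℕ i → h i ≤ h j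
  mono-+ zero j≡i = ≤-reflexive (cong (toℕ ∘ h) (toℕ-injective (sym j≡i)))
  mono-+ (suc d) {j = zero} ()
  mono-+ (suc d) {j = suc j} j≡ =
    ≤-trans (mono-+ d (trans (toℕ-inject₁ j) (ℕ.suc-injective j≡)))
            (IsHessenberg.monotone H (inject₁ j) (suc j) (cong suc (toℕ-inject₁ j)))

  mono : ∀ {i j : Fin n} → i ≤ j → h i ≤ h j
  mono {i} {j} i≤j = mono-+ (toℕ j ∸ toℕ i) (sym (ℕ.m∸n+n≡m i≤j))

  _≮P_ : Fin n → Fin n → Set
  j ≮P i = ¬ (_<P_ h j i)

  >⇒≮P : ∀ {x y : Fin n} → y < x → x ≮P y
  >⇒≮P {x} y<x = ≤⇒≯ (≤-trans (<⇒≤ y<x) (IsHessenberg.extensive H x))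

  Between : Fin n → Fin n → Set
  Between k x = k < x × x ≤ h k

  between? : ∀ k → Decidable (Between k)
  between? k x = (k <? x) ×-dec (x ≤? h k)

  incomparable≐between : ∀ {k} → (λ x → k < x × Incomparable h k x) ≐ Between k
  incomparable≐between =
    (λ (k<x , k≮x , _) → k<x , ≮⇒≥ k≮x) , (λ (k<x , x≤hk) → k<x , ≤⇒≯ x≤hk , >⇒≮P k<x)

  below : Fin n → List (Fin n) → List (Fin n)
  below k [] = []
  below k (x ∷ xs) with x ≟ k
  ... | yes _ = xs
  ... | no _  = below k xs

  below-here : ∀ k {xs} → below k (k ∷ xs) ≡ xs
  below-here k with k ≟ k
  ... | yes _  = refl
  ... | no k≢k = contradiction refl k≢k

  below-there : ∀ {k x xs} → x ≢ k → below k (x ∷ xs) ≡ below k xs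
  below-there {k} {x} x≢k with x ≟ k
  ... | yes x≡k = contradiction x≡k x≢k
  ... | no _    = refl

  below-++ : ∀ {k} xs {ys} → k ∉ xs → below k (xs ++ k ∷ ys) ≡ ys
  below-++ {k} [] k∉ = below-here k
  below-++ (x ∷ xs) k∉ = trans (below-there (λ x≡k → k∉ (here (sym x≡k)))) (below-++ xs (k∉ ∘ there))

  below-⊆ : ∀ k xs → below k xs ⊆ xs
  below-⊆ k [] = []
  below-⊆ k (x ∷ xs) with x ≟ k
  ... | yes _ = x ∷ʳ ⊆-refl
  ... | no _  = x ∷ʳ below-⊆ k xs

  code : List (Fin n) → Fin n → ℕ
  code T k = length (filter (between? k) (below k T))

  code-there : ∀ {x k xs} → x ≢ k → code (x ∷ xs) k ≡ code xs k
  code-there {k = k} x≢k = cong (length ∘ filter (between? k)) (below-there x≢k)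

  code-insert : ∀ {j k} xs {ys} → j ≢ k → ¬ Between j k → code (xs ++ k ∷ ys) j ≡ code (xs ++ ys) j
  code-insert {j} {k} [] j≢k _ = code-there (j≢k ∘ sym)
  code-insert {j} {k} (x ∷ xs) {ys} j≢k ¬jk with x ≟ j
  ... | yes _ = cong length (filter-insert-reject (between? j) xs ¬jk)
  ... | no _  = code-insert xs j≢k ¬jk

  inv≡sum-code : ∀ {T} → Unique T → inv h T ≡ sum (map (code T) T)
  inv≡sum-code [] = refl
  inv≡sum-code {x ∷ xs} (x≢ ∷ u) = cong₂ _+_
    (trans (cong length (filter-≐ _ (between? x) incomparable≐between xs))
           (cong (length ∘ filter (between? x)) (sym (below-here x))))
    (trans (inv≡sum-code u) (cong sum (sym (map-cong-local (All.map code-there x≢)))))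

  length-filter-between : ∀ {k C} → Unique C → (∀ {x} → Between k x → x ∈ C) →
                          length (filter (between? k) C) ≡ toℕ (h k) ∸ toℕ k
  length-filter-between {k} {C} u complete = begin
    length (filter (between? k) C)            ≡⟨ length-map toℕ (filter (between? k) C) ⟨
    length (map toℕ (filter (between? k) C))  ≡⟨ ↭-length (unique∧set⇒↭ u′ (interval-unique _ _) same) ⟩
    length (interval (toℕ k) (toℕ (h k)))     ≡⟨ length-interval (toℕ k) (toℕ (h k)) ⟩
    toℕ (h k) ∸ toℕ k                         ∎
    where
    open ≡-Reasoning
    u′ : Unique (map toℕ (filter (between? k) C))
    u′ = Unique.map⁺ toℕ-injective (Unique.filter⁺ (between? k) u)
    to : ∀ {v} → v ∈ map toℕ (filter (between? k) C) → toℕ k <ℕ v × v ≤ℕ toℕ (h k)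
    to v∈ with x , x∈ , refl ← ∈-map⁻ toℕ v∈ = proj₂ (∈-filter⁻ (between? k) {xs = C} x∈)
    from : ∀ {v} → toℕ k <ℕ v × v ≤ℕ toℕ (h k) → v ∈ map toℕ (filter (between? k) C)
    from {v} (k<v , v≤hk) = subst (_∈ map toℕ (filter (between? k) C)) (toℕ-fromℕ< v<n)
      (∈-map⁺ toℕ (∈-filter⁺ (between? k) (complete x-between) x-between))
      where
      v<n = ℕ.≤-<-trans v≤hk (toℕ<n (h k))
      x-between : Between k (fromℕ< v<n)
      x-between = subst (λ w → toℕ k <ℕ w × w ≤ℕ toℕ (h k)) (sym (toℕ-fromℕ< v<n)) (k<v , v≤hk)
    same : ∀ {v} → v ∈ map toℕ (filter (between? k) C) ⇔ v ∈ interval (toℕ k) (toℕ (h k))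
    same = mk⇔ (Equivalence.from ∈-interval ∘ to) (from ∘ Equivalence.to ∈-interval)

  nth1-++ : ∀ xs {y ys} → nth1 h (xs ++ y ∷ ys) (suc (length xs)) ≡ just y
  nth1-++ [] = refl
  nth1-++ (x ∷ xs) = nth1-++ xs

  nth1-reverse : ∀ xs y ys → nth1 h (reverse (xs ++ y ∷ ys)) (suc (length ys)) ≡ just y
  nth1-reverse xs y ys = begin
    nth1 h (reverse (xs ++ y ∷ ys)) (suc (length ys))
      ≡⟨ cong (λ zs → nth1 h zs (suc (length ys))) reverse-split ⟩
    nth1 h (reverse ys ++ y ∷ reverse xs) (suc (length ys))
      ≡⟨ cong (λ l → nth1 h (reverse ys ++ y ∷ reverse xs) (suc l)) (length-reverse ys) ⟨
    nth1 h (reverse ys ++ y ∷ reverse xs) (suc (length (reverse ys)))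
      ≡⟨ nth1-++ (reverse ys) ⟩
    just y
      ∎
    where
    open ≡-Reasoning
    reverse-split : reverse (xs ++ y ∷ ys) ≡ reverse ys ++ y ∷ reverse xs
    reverse-split = begin
      reverse (xs ++ y ∷ ys)             ≡⟨ reverse-++ xs (y ∷ ys) ⟩
      reverse (y ∷ ys) ++ reverse xs     ≡⟨ cong (_++ reverse xs) (unfold-reverse y ys) ⟩
      (reverse ys ++ [ y ]) ++ reverse xs ≡⟨ ++-assoc (reverse ys) [ y ] (reverse xs) ⟩
      reverse ys ++ y ∷ reverse xs       ∎

  insertAbove-++ : ∀ k {y} xs {ys} → y ∉ xs → insertAbove h k y (xs ++ y ∷ ys) ≡ xs ++ k ∷ y ∷ ys
  insertAbove-++ k {y} [] _ with y ≟ y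
  ... | yes _   = refl
  ... | no y≢y  = contradiction refl y≢y
  insertAbove-++ k {y} (x ∷ xs) y∉ with x ≟ y
  ... | yes x≡y = contradiction (here (sym x≡y)) y∉
  ... | no _    = cong (x ∷_) (insertAbove-++ k xs (y∉ ∘ there))

  step-suc : ∀ {k r C t} → nth1 h (reverse (filter (between? k) C)) (suc r) ≡ just t →
             step h k (suc r) C ≡ just (insertAbove h k t C)
  step-suc nth≡ rewrite nth≡ = refl

  step-insert : ∀ k xs ys → Unique (xs ++ ys) → Maybe.All (Between k) (head ys) →
                step h k (length (filter (between? k) ys)) (xs ++ ys) ≡ just (xs ++ k ∷ ys)
  step-insert k xs [] _ nothing = cong (λ zs → just (zs ++ [ k ])) (++-identityʳ xs)
  step-insert k xs (y ∷ ys) u (just k<y≤hk) = begin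
    step h k (length (filter (between? k) (y ∷ ys))) (xs ++ y ∷ ys)
      ≡⟨ cong (λ zs → step h k (length zs) (xs ++ y ∷ ys)) (filter-accept (between? k) k<y≤hk) ⟩
    step h k (suc (length (filter (between? k) ys))) (xs ++ y ∷ ys)
      ≡⟨ step-suc y-lowest ⟩
    just (insertAbove h k y (xs ++ y ∷ ys))
      ≡⟨ cong just (insertAbove-++ k xs (Unique-mid⇒∉ xs u ∘ ∈-++⁺ˡ)) ⟩
    just (xs ++ k ∷ y ∷ ys)
      ∎
    where
    open ≡-Reasoning
    y-lowest : nth1 h (reverse (filter (between? k) (xs ++ y ∷ ys))) (suc (length (filter (between? k) ys)))
               ≡ just y
    y-lowest = begin
      nth1 h (reverse (filter (between? k) (xs ++ y ∷ ys))) _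
        ≡⟨ cong (λ zs → nth1 h (reverse zs) _) (filter-++ (between? k) xs (y ∷ ys)) ⟩
      nth1 h (reverse (filter (between? k) xs ++ filter (between? k) (y ∷ ys))) _
        ≡⟨ cong (λ zs → nth1 h (reverse (filter (between? k) xs ++ zs)) _) (filter-accept (between? k) k<y≤hk) ⟩
      nth1 h (reverse (filter (between? k) xs ++ y ∷ filter (between? k) ys)) _
        ≡⟨ nth1-reverse (filter (between? k) xs) y (filter (between? k) ys) ⟩
      just y
        ∎

  record Stage (e : Fin n → ℕ) (k : Fin n) (C : List (Fin n)) : Set where
    field
      unique   : Unique C
      bounded  : ∀ {x} → x ∈ C → k ≤ x
      complete : ∀ {x} → k ≤ x → x ∈ C
      linked   : Linked _≮P_ C
      code≡    : ∀ {j} → k ≤ j → code C j ≡ e j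

  stage-insert : ∀ {e k k′} A {B} → k ⋖ k′ → Stage e k′ (A ++ B) → Maybe.All (Between k) (head B) →
                 length (filter (between? k) B) ≡ e k → Stage e k (A ++ k ∷ B)
  stage-insert {e} {k} {k′} A {B} k⋖k′ s head-between count≡ = record
    { unique   = Unique-insert A unique (λ k∈ → ℕ.<-irrefl refl (above k∈))
    ; bounded  = bounded′
    ; complete = complete′
    ; linked   = Linked-insert A linked (All.tabulate (>⇒≮P ∘ above ∘ ∈-++⁺ˡ))
                   (Maybe.map (λ (_ , y≤hk) → ≤⇒≯ y≤hk) head-between)
    ; code≡    = code≡′
    }
    where
    open Stage s
    above : ∀ {x} → x ∈ A ++ B → k < x
    above = ⋖-≤⇒< k⋖k′ ∘ bounded
    k∉A : k ∉ A
    k∉A k∈ = ℕ.<-irrefl refl (above (∈-++⁺ˡ k∈))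
    bounded′ : ∀ {x} → x ∈ A ++ k ∷ B → k ≤ x
    bounded′ x∈ with ∈-insert⁻ A x∈
    ... | inj₁ refl = ℕ.≤-refl
    ... | inj₂ x∈′  = <⇒≤ (above x∈′)
    complete′ : ∀ {x} → k ≤ x → x ∈ A ++ k ∷ B
    complete′ {x} k≤x with x ≟ k
    ... | yes refl = ∈-insert A
    ... | no x≢k   = ∈-insert⁺ A (complete (⋖-<⇒≤ k⋖k′ (≤∧≢⇒< k≤x (x≢k ∘ sym))))
    code≡′ : ∀ {j} → k ≤ j → code (A ++ k ∷ B) j ≡ e j
    code≡′ {j} k≤j with j ≟ k
    ... | yes refl = trans (cong (length ∘ filter (between? k)) (below-++ A k∉A)) count≡
    ... | no j≢k   = trans (code-insert A j≢k (λ (j<k , _) → ℕ.<-asym j<k k<j))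
                           (code≡ (⋖-<⇒≤ k⋖k′ k<j))
      where k<j = ≤∧≢⇒< k≤j (j≢k ∘ sym)

  stage-length-between : ∀ {e k k′ C} → k ⋖ k′ → Stage e k′ C →
                         length (filter (between? k) C) ≡ toℕ (h k) ∸ toℕ k
  stage-length-between k⋖k′ s =
    length-filter-between (Stage.unique s) (Stage.complete s ∘ ⋖-<⇒≤ k⋖k′ ∘ proj₁)

  stage-step : ∀ {e k k′ C} → k ⋖ k′ → e k ≤ℕ toℕ (h k) ∸ toℕ k → Stage e k′ C →
               ∃ λ C′ → step h k (e k) C ≡ just C′ × Stage e k C′
  stage-step {e} {k} {k′} {C} k⋖k′ ek≤ s
    with A , B , refl , count≡ , head-between ←
           split-by-count (between? k) C (subst (e k ≤ℕ_) (sym (stage-length-between k⋖k′ s)) ek≤)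
    = A ++ k ∷ B
    , subst (λ r → step h k r (A ++ B) ≡ just (A ++ k ∷ B)) count≡
            (step-insert k A B (Stage.unique s) head-between)
    , stage-insert A k⋖k′ s head-between count≡

  first-above : ∀ {k k′ a} → k ⋖ k′ → h a ≤ h k → ∀ xs → Linked _≮P_ (a ∷ xs) →
                Maybe.All (Between k) (head (filter (k′ ≤?_) xs))
  first-above k⋖k′ ha≤hk [] _ = nothing
  first-above {k} {k′} k⋖k′ ha≤hk (y ∷ xs) (a≮y ∷ l) with k′ ≤? y
  ... | yes k′≤y = subst (Maybe.All (Between k) ∘ head) (sym (filter-accept (k′ ≤?_) k′≤y))
                     (just (⋖-≤⇒< k⋖k′ k′≤y , ≤-trans (≮⇒≥ a≮y) ha≤hk))
  ... | no k′≰y  = subst (Maybe.All (Between k) ∘ head) (sym (filter-reject (k′ ≤?_) k′≰y))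
                     (first-above k⋖k′ (mono (⋖-≰⇒≤ k⋖k′ k′≰y)) xs l)

  tableau-step : ∀ {T k k′} → IsTableau h T → k ⋖ k′ →
                 step h k (code T k) (filter (k′ ≤?_) T) ≡ just (filter (k ≤?_) T)
  tableau-step {T} {k} {k′} (u , complete , linked) k⋖k′ with T₁ , T₂ , refl ← ∈-∃++ (complete k) = begin
    step h k (code T k) (filter (k′ ≤?_) T)             ≡⟨ cong₂ (step h k) code≡count filter-k′ ⟩
    step h k (length (filter (between? k) B)) (A ++ B)  ≡⟨ step-insert k A B unique-AB head-between ⟩
    just (A ++ k ∷ B)                                   ≡⟨ cong just filter-k ⟨
    just (filter (k ≤?_) T)                             ∎
    where
    open ≡-Reasoning
    A = filter (k′ ≤?_) T₁
    B = filter (k′ ≤?_) T₂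
    k∉T₁ : k ∉ T₁
    k∉T₁ = Unique-mid⇒∉ T₁ u ∘ ∈-++⁺ˡ
    k∉T₂ : k ∉ T₂
    k∉T₂ = Unique-mid⇒∉ T₁ u ∘ ∈-++⁺ʳ T₁
    filter-k′ : filter (k′ ≤?_) (T₁ ++ k ∷ T₂) ≡ A ++ B
    filter-k′ = trans (filter-insert-reject (k′ ≤?_) T₁ (ℕ.<-irrefl refl ∘ ⋖-≤⇒< k⋖k′))
                      (filter-++ (k′ ≤?_) T₁ T₂)
    filter-k : filter (k ≤?_) (T₁ ++ k ∷ T₂) ≡ A ++ k ∷ B
    filter-k = begin
      filter (k ≤?_) (T₁ ++ k ∷ T₂)
        ≡⟨ filter-++ (k ≤?_) T₁ (k ∷ T₂) ⟩
      filter (k ≤?_) T₁ ++ filter (k ≤?_) (k ∷ T₂)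
        ≡⟨ cong (filter (k ≤?_) T₁ ++_) (filter-accept (k ≤?_) ℕ.≤-refl) ⟩
      filter (k ≤?_) T₁ ++ k ∷ filter (k ≤?_) T₂
        ≡⟨ cong₂ (λ xs ys → xs ++ k ∷ ys) (filter-≤-⋖ k⋖k′ k∉T₁) (filter-≤-⋖ k⋖k′ k∉T₂) ⟩
      A ++ k ∷ B
        ∎
    code≡count : code T k ≡ length (filter (between? k) B)
    code≡count = cong length (trans (cong (filter (between? k)) (below-++ T₁ k∉T₁))
                               (sym (filter-filter (between? k) (k′ ≤?_) (⋖-<⇒≤ k⋖k′ ∘ proj₁) T₂)))
    unique-AB : Unique (A ++ B)
    unique-AB = subst Unique filter-k′ (Unique.filter⁺ (k′ ≤?_) u)
    head-between : Maybe.All (Between k) (head B)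
    head-between = first-above k⋖k′ ℕ.≤-refl T₂ (Linked-++⁻ʳ T₁ linked)

  code-InN : ∀ {T} → IsTableau h T → InN h (code T)
  code-InN {T} (u , complete , _) k = begin
    code T k
      ≤⟨ length-mono-≤ (filter⁺ (between? k) (between? k) (λ { refl → id }) (below-⊆ k T)) ⟩
    length (filter (between? k) T)
      ≡⟨ length-filter-between u (λ {x} _ → complete x) ⟩
    toℕ (h k) ∸ toℕ k
      ∎
    where open ℕ.≤-Reasoning

  tableau↭allFin : ∀ {T} → IsTableau h T → T ↭ allFin n
  tableau↭allFin (u , complete , _) =
    unique∧set⇒↭ u (Unique.allFin⁺ n) (mk⇔ (λ _ → ∈-allFin _) (λ _ → complete _))

  degree-code : ∀ {T} → IsTableau h T → degree (code T) ≡ inv h T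
  degree-code {T} tab = begin
    sum (map (code T) (allFin n))  ≡⟨ sum-↭ (Perm.map⁺ (code T) (tableau↭allFin tab)) ⟨
    sum (map (code T) T)           ≡⟨ inv≡sum-code (proj₁ tab) ⟨
    inv h T                        ∎
    where open ≡-Reasoning

module _ {m} {h : Fin (suc m) → Fin (suc m)} (H : IsHessenberg h) where

  open Hessenberg H

  top : Fin (suc m)
  top = fromℕ m

  top≤⇒≡top : ∀ {x} → top ≤ x → x ≡ top
  top≤⇒≡top {x} = ≤-antisym (≤fromℕ x)

  InN⇒top≡0 : ∀ {e} → InN h e → e top ≡ 0
  InN⇒top≡0 inN = ℕ.n≤0⇒n≡0 (≤-trans (inN top) (≤-reflexive (ℕ.m≤n⇒m∸n≡0 (≤fromℕ (h top)))))

  stage-top : ∀ {e} → InN h e → Stage e top [ top ]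
  stage-top {e} inN = record
    { unique   = [] ∷ []
    ; bounded  = λ { (here refl) → ℕ.≤-refl }
    ; complete = here ∘ top≤⇒≡top
    ; linked   = [-]
    ; code≡    = λ top≤j → subst (λ j → code [ top ] j ≡ e j) (sym (top≤⇒≡top top≤j)) code-top
    }
    where
    code-top : code [ top ] top ≡ e top
    code-top = trans (cong (length ∘ filter (between? top)) (below-here top)) (sym (InN⇒top≡0 inN))

  filter-top : ∀ {T} → IsTableau h T → filter (top ≤?_) T ≡ [ top ]
  filter-top {T} (u , complete , _) with T₁ , T₂ , refl ← ∈-∃++ (complete top) = begin
    filter (top ≤?_) (T₁ ++ top ∷ T₂)
      ≡⟨ filter-++ (top ≤?_) T₁ (top ∷ T₂) ⟩
    filter (top ≤?_) T₁ ++ filter (top ≤?_) (top ∷ T₂)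
      ≡⟨ cong (filter (top ≤?_) T₁ ++_) (filter-accept (top ≤?_) ℕ.≤-refl) ⟩
    filter (top ≤?_) T₁ ++ top ∷ filter (top ≤?_) T₂
      ≡⟨ cong₂ (λ xs ys → xs ++ top ∷ ys) (none (top∉ ∘ ∈-++⁺ˡ {ys = T₂})) (none (top∉ ∘ ∈-++⁺ʳ T₁)) ⟩
    [ top ]
      ∎
    where
    open ≡-Reasoning
    top∉ = Unique-mid⇒∉ T₁ u
    none : ∀ {xs} → top ∉ xs → filter (top ≤?_) xs ≡ []
    none {xs} top∉xs =
      filter-none (top ≤?_) (All.tabulate (λ x∈ top≤x → top∉xs (subst (_∈ xs) (top≤⇒≡top top≤x) x∈)))

  φ-tableau : ∀ {e} → InN h e → ∃ λ T → φ h e ≡ just T × IsTableau h T × (∀ k → code T k ≡ e k)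
  φ-tableau {e} inN
    with T , φ≡ , s ← descending-induction (λ k acc → ∃ λ C → acc ≡ just C × Stage e k C)
                        (λ k acc → acc >>= step h k (e k)) ([ top ] , refl , stage-top inN)
                        (λ { k⋖k′ (C , refl , s) → stage-step k⋖k′ (inN _) s })
    = T , φ≡ , (unique , (λ _ → complete z≤n) , linked) , (λ _ → code≡ z≤n)
    where open Stage s

  φ-code : ∀ {T} → IsTableau h T → φ h (code T) ≡ just T
  φ-code {T} tab = trans
    (descending-induction (λ k acc → acc ≡ just (filter (k ≤?_) T)) (λ k acc → acc >>= step h k (code T k))
       (cong just (sym (filter-top tab))) (λ { k⋖k′ refl → tableau-step tab k⋖k′ }))
    (cong just (filter-all (zero {n = m} ≤?_) {xs = T} (All.tabulate (λ _ → z≤n))))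

theoremD : (m : ℕ) (h : Fin (suc m) → Fin (suc m)) → IsHessenberg h →
    -- well defined, lands in P_h-tableaux, and degree = number of inversions
    ((e : Fin (suc m) → ℕ) → InN h e →
        ∃ λ (T : List (Fin (suc m))) → φ h e ≡ just T × IsTableau h T × degree e ≡ inv h T)
    -- injective on 𝒩_h
    × ((e e′ : Fin (suc m) → ℕ) → InN h e → InN h e′ → φ h e ≡ φ h e′ → ∀ k → e k ≡ e′ k)
    -- surjective onto the P_h-tableaux of shape (1^n)
    × ((T : List (Fin (suc m))) → IsTableau h T → ∃ λ (e : Fin (suc m) → ℕ) → InN h e × φ h e ≡ just T)
theoremD m h H = well-defined , injective , surjective
  where
  open Hessenberg H
  well-defined : ∀ e → InN h e → ∃ λ T → φ h e ≡ just T × IsTableau h T × degree e ≡ inv h T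
  well-defined e inN with T , φ≡ , tab , code≡ ← φ-tableau H inN =
    T , φ≡ , tab , trans (cong sum (map-cong (sym ∘ code≡) (allFin (suc m)))) (degree-code tab)
  injective : ∀ e e′ → InN h e → InN h e′ → φ h e ≡ φ h e′ → ∀ k → e k ≡ e′ k
  injective e e′ inN inN′ φ≡φ′ k
    with T , φ≡ , _ , code≡ ← φ-tableau H inN | T′ , φ≡′ , _ , code≡′ ← φ-tableau H inN′
    with refl ← just-injective (trans (sym φ≡) (trans φ≡φ′ φ≡′)) = trans (sym (code≡ k)) (code≡′ k)
  surjective : ∀ T → IsTableau h T → ∃ λ e → InN h e × φ h e ≡ just T
  surjective T tab = code T , code-InN tab , φ-code H tab
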